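{- Let $q$ be a positive integer and $a_1,a_2,a_3$ distinct reduced residues mod $q$ with $a_1^2\equiv a_2^2\equiv a_3^2\pmod q$, all quadratic residues or all quadratic nonresidues mod $q$. For any permutation $(i,j,k)$ of $(1,2,3)$ and any Dirichlet character $\chi\bmod q$, \[ \overline\chi(a_i)+\overline\chi(a_0)-\overline\chi(a_j)-\overline\chi(a_k)=\begin{cases}4\overline\chi(a_i),&\chi\in H_i,\\0,&\text{otherwise}.\end{cases} \]
   Context: $a_0$ denotes the residue $a_ia_ja_k^{ -1}\bmod q$ (which does not depend on the permutation). $H_1=\{\chi:\chi(a_2)=\chi(a_3)=-\chi(a_1)\}$, $H_2=\{\chi:\chi(a_1)=\chi(a_3)=-\chi(a_2)\}$, $H_3=\{\chi:\chi(a_1)=\chi(a_2)=-\chi(a_3)\}$, $\chi$ ranging over Dirichlet characters mod $q$. -}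

module Defs where

open import Level using (Level; _⊔_)
open import Data.Nat using (ℕ; _*_; _%_; NonZero)
open import Data.Nat.Coprimality using (Coprime)
open import Data.Fin using (Fin)
open import Data.Product using (Σ; ∃; _×_)
open import Data.Sum using (_⊎_)
open import Relation.Nullary using (¬_)
open import Relation.Binary.PropositionalEquality using (_≡_; _≢_)
open import Algebra.Bundles using (CommutativeRing)

ModEq : (q : ℕ) → .{{NonZero q}} → ℕ → ℕ → Set
ModEq q a b = a % q ≡ b % q

-- a is a quadratic residue mod q (a is assumed coprime to q where used)
IsQR : (q : ℕ) → .{{NonZero q}} → ℕ → Set
IsQR q a = ∃ λ x → ModEq q (x * x) (a)

-- R has no zero divisors and is nontrivial (an integral domain);
-- stand-in for the complex numbers, which agda-stdlib lacks.
record IsIntegralDomain {c ℓ : Level} (R : CommutativeRing c ℓ) : Set (c ⊔ ℓ) where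
  open CommutativeRing R renaming (_*_ to _·_)
  field
    nontrivial   : ¬ (1# ≈ 0#)
    noZeroDivisors : ∀ x y → x · y ≈ 0# → (x ≈ 0#) ⊎ (y ≈ 0#)

record DirichletChar {c ℓ : Level} (R : CommutativeRing c ℓ)
                     (q : ℕ) .{{_ : NonZero q}} : Set (c ⊔ ℓ) where
  open CommutativeRing R renaming (_*_ to _·_)
  field
    χ          : ℕ → Carrier
    periodic   : ∀ a b → ModEq q (a) (b) → χ a ≈ χ b
    mult       : ∀ a b → χ (a * b) ≈ χ a · χ b
    one        : χ 1 ≈ 1#
    nonCoprime : ∀ a → ¬ Coprime a q → χ a ≈ 0#
    coprimeNZ  : ∀ a → Coprime a q → ¬ (χ a ≈ 0#)

-- χ̄ is the complex conjugate character of χ: for reduced residues a,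
-- χ̄(a) = χ(a)⁻¹ (= conj χ(a) in ℂ, as χ(a) is a root of unity).
IsConjugate : {c ℓ : Level} {R : CommutativeRing c ℓ} {q : ℕ} .{{_ : NonZero q}}
              → DirichletChar R q → DirichletChar R q → Set ℓ
IsConjugate {R = R} {q} χ χ̄ =
  ∀ a → Coprime a q → DirichletChar.χ χ a · DirichletChar.χ χ̄ a ≈ 1#
  where open CommutativeRing R renaming (_*_ to _·_)

InH : {c ℓ : Level} {R : CommutativeRing c ℓ} {q : ℕ} .{{_ : NonZero q}}
      → DirichletChar R q → (Fin 3 → ℕ) → Fin 3 → Set ℓ
InH {R = R} χ a i = ∀ l → l ≢ i → DirichletChar.χ χ (a l) ≈ - DirichletChar.χ χ (a i)
  where open CommutativeRing R

module Submission where

-- Put x = χ̄(a_i), y = χ̄(a_j), z = χ̄(a_k), w = χ̄(a₀).  From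
-- a_j² ≡ a_k² ≡ a_i² and a₀a_k ≡ a_ia_j, multiplicativity and periodicity of
-- χ̄ give y² = z² = x² and wz = xy, and z ≠ 0 since a_k is a reduced residue.
-- In an integral domain y = ±x and z = ±x, so the expression
-- E = (x + w) - (y + z) falls into two cases:
--   * y = x or z = x: cancelling z in wz = xy shows w = z resp. w = y,
--     and E = 0;
--   * y = z = -x: then w = x and E = 4x.
-- Finally, since χ̄(a) = χ(a)⁻¹ on reduced residues, χ̄(a_l) = -χ̄(a_i) iff
-- χ(a_l) = -χ(a_i), so the second case is exactly χ ∈ H_i.

open import Defs
open import Level using (Level)
open import Data.Nat using (ℕ; _*_; NonZero)
open import Data.Nat.Coprimality using (Coprime)
open import Data.Fin using (Fin)
open import Data.Product using (_×_)
open import Data.Sum using (_⊎_)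
open import Relation.Nullary using (¬_)
open import Relation.Binary.PropositionalEquality using (_≢_)
open import Algebra.Bundles using (CommutativeRing)

open import Data.Fin using (_≟_)
open import Data.Fin.Properties using (all?)
open import Data.Product using (_,_)
open import Data.Sum using (inj₁; inj₂)
open import Data.Unit using (tt)
open import Data.Empty using (⊥-elim)
open import Relation.Nullary using (¬?; _→-dec_; _⊎-dec_)
open import Relation.Nullary.Decidable using (toWitness)
open import Relation.Binary.PropositionalEquality as ≡ using (_≡_)
import Algebra.Properties.Ring as RingProperties
import Relation.Binary.Reasoning.Setoid as SetoidReasoning

module CommutativeRingFacts {c ℓ : Level} (R : CommutativeRing c ℓ) where
  open CommutativeRing R renaming (_*_ to _·_)
  open RingProperties ring
  open SetoidReasoning setoid

  inverse-unique : ∀ {p p′ s} → p · p′ ≈ 1# → p · s ≈ 1# → p′ ≈ s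
  inverse-unique {p} {p′} {s} pp′≈1 ps≈1 = begin
    p′             ≈⟨ *-identityʳ p′ ⟨
    p′ · 1#        ≈⟨ *-congˡ ps≈1 ⟨
    p′ · (p · s)   ≈⟨ *-assoc p′ p s ⟨
    (p′ · p) · s   ≈⟨ *-congʳ (trans (*-comm p′ p) pp′≈1) ⟩
    1# · s         ≈⟨ *-identityˡ s ⟩
    s              ∎

  -- If p = -r then p⁻¹ = -r⁻¹; this transports the sign conditions
  -- defining H_i from a character to its conjugate and back.
  inverse-of-negation : ∀ {p p′ r r′} → p · p′ ≈ 1# → r · r′ ≈ 1# →
                        p ≈ - r → p′ ≈ - r′
  inverse-of-negation {p} {p′} {r} {r′} pp′≈1 rr′≈1 p≈-r =
    inverse-unique pp′≈1 (begin
      p · - r′     ≈⟨ *-congʳ p≈-r ⟩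
      - r · - r′   ≈⟨ -‿distribˡ-* r (- r′) ⟨
      - (r · - r′) ≈⟨ -‿cong (-‿distribʳ-* r r′) ⟨
      - - (r · r′) ≈⟨ -‿involutive (r · r′) ⟩
      r · r′       ≈⟨ rr′≈1 ⟩
      1#           ∎)

fourTermSum : {c ℓ : Level} (R : CommutativeRing c ℓ) →
              let open CommutativeRing R in Carrier → Carrier → Carrier → Carrier → Carrier
fourTermSum R x w y z = (x + w) - (y + z)
  where open CommutativeRing R

module IntegralDomainFacts {c ℓ : Level} (R : CommutativeRing c ℓ)
                           (domain : IsIntegralDomain R) where
  open CommutativeRing R renaming (_*_ to _·_)
  open IsIntegralDomain domain
  open RingProperties ring
  open SetoidReasoning setoid

  cancelʳ : ∀ {u v d} → ¬ (d ≈ 0#) → u · d ≈ v · d → u ≈ v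
  cancelʳ {u} {v} {d} d≉0 ud≈vd
    with noZeroDivisors (u - v) d (trans ([y-z]x≈yx-zx d u v) (x≈y⇒x∙y⁻¹≈ε ud≈vd))
  ... | inj₁ u-v≈0 = x∙y⁻¹≈ε⇒x≈y u v u-v≈0
  ... | inj₂ d≈0   = ⊥-elim (d≉0 d≈0)

  square-roots : ∀ {x y} → y · y ≈ x · x → y ≈ x ⊎ y ≈ - x
  square-roots {x} {y} yy≈xx with noZeroDivisors (y - x) (y + x) product≈0
    where
    product≈0 : (y - x) · (y + x) ≈ 0#
    product≈0 = begin
      (y - x) · (y + x)                  ≈⟨ distribˡ (y - x) y x ⟩
      (y - x) · y + (y - x) · x          ≈⟨ +-cong ([y-z]x≈yx-zx y y x) ([y-z]x≈yx-zx x y x) ⟩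
      (y · y - x · y) + (y · x - x · x)  ≈⟨ +-cong (+-congʳ yy≈xx) (+-congʳ (*-comm y x)) ⟩
      (x · x - x · y) + (x · y - x · x)  ≈⟨ +-congˡ (⁻¹-anti-homo‿- (x · x) (x · y)) ⟨
      (x · x - x · y) - (x · x - x · y)  ≈⟨ -‿inverseʳ _ ⟩
      0#                                 ∎
  ... | inj₁ y-x≈0 = inj₁ (x∙y⁻¹≈ε⇒x≈y y x y-x≈0)
  ... | inj₂ y+x≈0 = inj₂ (+-inverseˡ-unique y x y+x≈0)

  sign-dichotomy : ∀ {x y z} → y · y ≈ x · x → z · z ≈ x · x →
                   (y ≈ x ⊎ z ≈ x) ⊎ (y ≈ - x × z ≈ - x)
  sign-dichotomy yy≈xx zz≈xx with square-roots yy≈xx | square-roots zz≈xx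
  ... | inj₁ y≈x  | _         = inj₁ (inj₁ y≈x)
  ... | inj₂ _    | inj₁ z≈x  = inj₁ (inj₂ z≈x)
  ... | inj₂ y≈-x | inj₂ z≈-x = inj₂ (y≈-x , z≈-x)

  -- If y = x or z = x, the relation wz = xy pairs w with the other one,
  -- so the four-term sum cancels.
  four-term-vanishes : ∀ {x y z w} → ¬ (z ≈ 0#) → z · z ≈ x · x → w · z ≈ x · y →
                       y ≈ x ⊎ z ≈ x → fourTermSum R x w y z ≈ 0#
  four-term-vanishes {x} {y} {z} {w} z≉0 zz≈xx wz≈xy (inj₁ y≈x) = begin
    (x + w) - (y + z)  ≈⟨ +-cong (+-congˡ w≈z) (-‿cong (+-congʳ y≈x)) ⟩
    (x + z) - (x + z)  ≈⟨ -‿inverseʳ (x + z) ⟩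
    0#                 ∎
    where
    w≈z : w ≈ z
    w≈z = cancelʳ z≉0 (trans wz≈xy (trans (*-congˡ y≈x) (sym zz≈xx)))
  four-term-vanishes {x} {y} {z} {w} z≉0 _ wz≈xy (inj₂ z≈x) = begin
    (x + w) - (y + z)  ≈⟨ +-congʳ (+-cong (sym z≈x) w≈y) ⟩
    (z + y) - (y + z)  ≈⟨ +-congˡ (-‿cong (+-comm y z)) ⟩
    (z + y) - (z + y)  ≈⟨ -‿inverseʳ (z + y) ⟩
    0#                 ∎
    where
    w≈y : w ≈ y
    w≈y = cancelʳ z≉0 (trans wz≈xy (trans (*-comm x y) (*-congˡ (sym z≈x))))

  four-times : ∀ x → (x + x) + (x + x) ≈ (1# + 1# + 1# + 1#) · x
  four-times x = begin
    (x + x) + (x + x)                       ≈⟨ +-assoc (x + x) x x ⟨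
    ((x + x) + x) + x                       ≈⟨ +-cong (+-cong (+-cong 1x≈x 1x≈x) 1x≈x) 1x≈x ⟨
    ((1# · x + 1# · x) + 1# · x) + 1# · x   ≈⟨ +-congʳ (+-congʳ (distribʳ x 1# 1#)) ⟨
    ((1# + 1#) · x + 1# · x) + 1# · x       ≈⟨ +-congʳ (distribʳ x (1# + 1#) 1#) ⟨
    (1# + 1# + 1#) · x + 1# · x             ≈⟨ distribʳ x (1# + 1# + 1#) 1# ⟨
    (1# + 1# + 1# + 1#) · x                 ∎
    where
    1x≈x : 1# · x ≈ x
    1x≈x = *-identityˡ x

  -- If y = z = -x, then wz = xy forces w = x and the sum is 4x.
  four-term-quadruples : ∀ {x y z w} → ¬ (z ≈ 0#) → w · z ≈ x · y →
                         y ≈ - x → z ≈ - x → fourTermSum R x w y z ≈ (1# + 1# + 1# + 1#) · x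
  four-term-quadruples {x} {y} {z} {w} z≉0 wz≈xy y≈-x z≈-x = begin
    (x + w) - (y + z)      ≈⟨ +-cong (+-congˡ w≈x) (-‿cong (+-cong y≈-x z≈-x)) ⟩
    (x + x) - (- x + - x)  ≈⟨ +-congˡ (-‿cong (-‿+-comm x x)) ⟩
    (x + x) + - - (x + x)  ≈⟨ +-congˡ (-‿involutive (x + x)) ⟩
    (x + x) + (x + x)      ≈⟨ four-times x ⟩
    (1# + 1# + 1# + 1#) · x ∎
    where
    w≈x : w ≈ x
    w≈x = cancelʳ z≉0 (trans wz≈xy (*-congˡ (trans y≈-x (sym z≈-x))))

-- In Fin 3, an index different from i is one of the other two indices of
-- a permutation (i, j, k); checked by enumerating the 81 cases.
other-indices : (i j k l : Fin 3) → i ≢ j → i ≢ k → j ≢ k → l ≢ i → l ≡ j ⊎ l ≡ k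
other-indices = toWitness {a? = all? λ i → all? λ j → all? λ k → all? λ l →
  ¬? (i ≟ j) →-dec ¬? (i ≟ k) →-dec ¬? (j ≟ k) →-dec ¬? (l ≟ i) →-dec (l ≟ j ⊎-dec l ≟ k)} tt

module CharacterFacts {c ℓ : Level} {R : CommutativeRing c ℓ} {q : ℕ} .{{_ : NonZero q}} where
  open CommutativeRing R renaming (_*_ to _·_)
  open CommutativeRingFacts R

  product-relation : (χ : DirichletChar R q) → ∀ {m n m′ n′} → ModEq q (m * n) (m′ * n′) →
                     DirichletChar.χ χ m · DirichletChar.χ χ n ≈ DirichletChar.χ χ m′ · DirichletChar.χ χ n′
  product-relation χ {m} {n} {m′} {n′} mn≡m′n′ =
    trans (sym (mult m n)) (trans (periodic (m * n) (m′ * n′) mn≡m′n′) (mult m′ n′))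
    where open DirichletChar χ

  conjugate-negation : (χ χ̄ : DirichletChar R q) → IsConjugate χ χ̄ →
                       ∀ {b b′} → Coprime b q → Coprime b′ q →
                       DirichletChar.χ χ b ≈ - DirichletChar.χ χ b′ →
                       DirichletChar.χ χ̄ b ≈ - DirichletChar.χ χ̄ b′
  conjugate-negation χ χ̄ conj {b} {b′} b⊥q b′⊥q =
    inverse-of-negation (conj b b⊥q) (conj b′ b′⊥q)

  conjugate-symmetric : (χ χ̄ : DirichletChar R q) → IsConjugate χ χ̄ → IsConjugate χ̄ χ
  conjugate-symmetric χ χ̄ conj b b⊥q = trans (*-comm _ _) (conj b b⊥q)

  InH-from-pair : (χ : DirichletChar R q) (a : Fin 3 → ℕ) (i j k : Fin 3) →
                  i ≢ j → i ≢ k → j ≢ k →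
                  DirichletChar.χ χ (a j) ≈ - DirichletChar.χ χ (a i) →
                  DirichletChar.χ χ (a k) ≈ - DirichletChar.χ χ (a i) → InH χ a i
  InH-from-pair χ a i j k i≢j i≢k j≢k at-j at-k l l≢i with other-indices i j k l i≢j i≢k j≢k l≢i
  ... | inj₁ ≡.refl = at-j
  ... | inj₂ ≡.refl = at-k

lemma3p4 : {c ℓ : Level} (R : CommutativeRing c ℓ) → IsIntegralDomain R →
    (q : ℕ) .{{_ : NonZero q}} (a : Fin 3 → ℕ) →
    (∀ l → Coprime (a l) q) →
    (∀ l m → l ≢ m → ¬ ModEq q (a l) (a m)) →
    (∀ l m → ModEq q (a l * a l) (a m * a m)) →
    ((∀ l → IsQR q (a l)) ⊎ (∀ l → ¬ IsQR q (a l))) →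
    (i j k : Fin 3) → i ≢ j → i ≢ k → j ≢ k →
    (a₀ : ℕ) → ModEq q (a₀ * a k) (a i * a j) →
    (χ χ̄ : DirichletChar R q) → IsConjugate χ χ̄ →
    let open CommutativeRing R renaming (_*_ to _·_)
        X = DirichletChar.χ χ̄
        E = (X (a i) + X a₀) - (X (a j) + X (a k))
    in (InH χ a i → E ≈ (1# + 1# + 1# + 1#) · X (a i))
     × (¬ InH χ a i → E ≈ 0#)
lemma3p4 R domain q a reduced _ squares _ i j k i≢j i≢k j≢k a₀ a₀-relation χ χ̄ conj =
  in-H , not-in-H
  where
  open CommutativeRing R renaming (_*_ to _·_)
  open IntegralDomainFacts R domain
  open CharacterFacts
  X = DirichletChar.χ χ̄

  to-conjugate : ∀ l → DirichletChar.χ χ (a l) ≈ - DirichletChar.χ χ (a i) → X (a l) ≈ - X (a i)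
  to-conjugate l = conjugate-negation χ χ̄ conj (reduced l) (reduced i)

  from-conjugate : ∀ l → X (a l) ≈ - X (a i) → DirichletChar.χ χ (a l) ≈ - DirichletChar.χ χ (a i)
  from-conjugate l = conjugate-negation χ̄ χ (conjugate-symmetric χ χ̄ conj) (reduced l) (reduced i)

  square-relation : ∀ l → X (a l) · X (a l) ≈ X (a i) · X (a i)
  square-relation l = product-relation χ̄ (squares l i)

  z≉0 : ¬ (X (a k) ≈ 0#)
  z≉0 = DirichletChar.coprimeNZ χ̄ (a k) (reduced k)

  wz≈xy : X a₀ · X (a k) ≈ X (a i) · X (a j)
  wz≈xy = product-relation χ̄ a₀-relation

  in-H : InH χ a i → fourTermSum R (X (a i)) (X a₀) (X (a j)) (X (a k)) ≈ (1# + 1# + 1# + 1#) · X (a i)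
  in-H χ∈H = four-term-quadruples z≉0 wz≈xy
    (to-conjugate j (χ∈H j (λ j≡i → i≢j (≡.sym j≡i))))
    (to-conjugate k (χ∈H k (λ k≡i → i≢k (≡.sym k≡i))))

  not-in-H : ¬ InH χ a i → fourTermSum R (X (a i)) (X a₀) (X (a j)) (X (a k)) ≈ 0#
  not-in-H χ∉H with sign-dichotomy (square-relation j) (square-relation k)
  ... | inj₁ y≈x⊎z≈x = four-term-vanishes z≉0 (square-relation k) wz≈xy y≈x⊎z≈x
  ... | inj₂ (y≈-x , z≈-x) = ⊥-elim (χ∉H (InH-from-pair χ a i j k i≢j i≢k j≢k
          (from-conjugate j y≈-x) (from-conjugate k z≈-x)))
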